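{- Let $G$ and $B$ be finite sets. For each $g \in G$ let $B_g \subseteq B$ and for each $b \in B$ let $G_b \subseteq G$. Put $G_L = \{g \in G : B_g \neq \varnothing\}$ and $B_L = \{b \in B : G_b \neq \varnothing\}$. For $g \in G_L$ let $B^*_g = \{b \in B_g : b \notin B_L \text{ or } g \in G_b\}$, and for $b \in B_L$ let $G^*_b = \{g \in G_b : g \notin G_L \text{ or } b \in B_g\}$. Then there exists an injective partial function $P : G \to B$ with $G_L \subseteq \mathrm{Domain}(P)$, $B_L \subseteq \mathrm{Range}(P)$, $P(g) \in B_g$ for all $g \in G_L$, and $P^{ -1}(b) \in G_b$ for all $b \in B_L$, if and only if for every $\beta \subseteq B_L$ we have $\left|\bigcup_{b \in \beta} G^*_b\right| \geq |\beta|$, and for every $\gamma \subseteq G_L$ we have $\left|\bigcup_{g \in \gamma} B^*_g\right| \geq |\gamma|$.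
   Context: This is the "Symmetric Marriage Problem": $B_g$ is the list of boys girl $g$ is willing to marry and $G_b$ the list of girls boy $b$ is willing to marry; an empty list means the person has no list (is willing to marry anyone or no one). $G_L$, $B_L$ are the girls and boys with lists. -}

module Defs where

open import Data.Nat using (ℕ)
open import Data.Bool using (Bool; true; false; _∧_; _∨_; not)
open import Data.Fin using (Fin)
open import Data.Fin.Subset using (Subset; ⋃)
open import Data.Fin.Subset.Properties using (nonempty?; _∈?_)
open import Data.Vec using (tabulate; lookup)
open import Data.List using (List; map; filter; allFin)
open import Data.Maybe using (Maybe; just)
open import Data.Product using (Σ; _×_)
open import Relation.Nullary.Decidable using (isYes)
open import Relation.Binary.PropositionalEquality using (_≡_)

-- Girls are Fin m, boys are Fin n.
-- Bl g : the list B_g ⊆ B of girl g;  Gl b : the list G_b ⊆ G of boy b.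

GirlsL : ∀ {m n} → (Fin m → Subset n) → Subset m
GirlsL Bl = tabulate (λ g → isYes (nonempty? (Bl g)))

BoysL : ∀ {m n} → (Fin n → Subset m) → Subset n
BoysL Gl = tabulate (λ b → isYes (nonempty? (Gl b)))

BStar : ∀ {m n} → (Fin m → Subset n) → (Fin n → Subset m) → Fin m → Subset n
BStar Bl Gl g = tabulate (λ b → lookup (Bl g) b ∧ (not (lookup (BoysL Gl) b) ∨ lookup (Gl b) g))

GStar : ∀ {m n} → (Fin m → Subset n) → (Fin n → Subset m) → Fin n → Subset m
GStar Bl Gl b = tabulate (λ g → lookup (Gl b) g ∧ (not (lookup (GirlsL Bl) g) ∨ lookup (Bl g) b))

bigUnion : ∀ {k n} → Subset k → (Fin k → Subset n) → Subset n
bigUnion {k} β f = ⋃ (map f (filter (_∈? β) (allFin k)))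

InjectivePartial : ∀ {m n} → (Fin m → Maybe (Fin n)) → Set
InjectivePartial P = ∀ g g′ b → P g ≡ just b → P g′ ≡ just b → g ≡ g′

module Submission where

-- Consider the bipartite graph in which girl g and boy b are joined when b ∈ B*_g or
-- g ∈ G*_b; every edge respects both lists wherever the lists exist.  A marriage scheme
-- is then a matching of this graph saturating G_L on the girls' side and B_L on the boys'.
--
--  * Necessity: a scheme marries each g ∈ G_L inside B*_g and each b ∈ B_L inside G*_b,
--    and injectivity gives both Hall inequalities (a pigeonhole count for subsets).
--  * Sufficiency: by Hall's marriage theorem the two Hall conditions give a matching
--    saturating G_L inside the sets B*_g and one saturating B_L inside the sets G*_b.
--    The Mendelsohn–Dulmage argument merges them: while some boy y ∈ B_L is unmatched,
--    marry him to his partner a from the boys' matching; this strictly increases the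
--    number of girls on which the two matchings agree, so the process terminates.

open import Defs
open import Data.Bool using (Bool; true; false; _∧_; _∨_; not)
open import Data.Nat using (ℕ; zero; suc; _+_; _≤_; _<_; _≥_; _≤?_; _<?_; z≤n; s≤s)
open import Data.Nat.Properties
  using (≤-refl; ≤-reflexive; ≤-trans; <-≤-trans; ≤-<-trans; ≤⇒≯; ≰⇒>; m≤n+m; +-comm;
         +-identityʳ; +-suc; +-monoˡ-≤; +-monoʳ-≤; +-cancelʳ-≤; module ≤-Reasoning)
open import Data.Fin using (Fin; zero; suc; _≟_)
open import Data.Fin.Properties using (any?; suc-injective; 0≢1+n)
open import Data.Fin.Subset
  using (Subset; _∈_; _∉_; _⊆_; _⊂_; ∣_∣; _∪_; _─_; _-_; ⁅_⁆; ⋃; Nonempty; Empty)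
open import Data.Fin.Subset.Properties
  using (_∈?_; _⊆?_; ∣p∣≤n; nonempty?; Empty-unique; ∣⊥∣≡0; ∉⊥; ∣⁅x⁆∣≡1; x∈⁅x⁆; x∈⁅y⁆⇒x≡y;
         p⊆q⇒∣p∣≤∣q∣; p⊂q⇒∣p∣<∣q∣; ∣p∣≤∣p∪q∣; x∈p∪q⁺; x∈p∪q⁻; p─q⊆p; x∈p∧x∉q⇒x∈p─q;
         x∈p∧x≢y⇒x∈p-y; x∈p⇒∣p-x∣<∣p∣; p∩q≢∅⇒∣p─q∣<∣p∣; x∈p∩q⁺; anySubset?)
open import Data.Vec using ([]; _∷_; here; there; lookup; tabulate)
open import Data.Vec.Properties using (lookup∘tabulate; []=⇒lookup; lookup⇒[]=)
open import Data.List using (List; []; _∷_; map; filter; allFin)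
open import Data.List.Membership.Propositional using () renaming (_∈_ to _∈ₗ_)
open import Data.List.Membership.Propositional.Properties using (∈-map∘filter⁺; ∈-map∘filter⁻; ∈-allFin)
open import Data.List.Relation.Unary.Any using (here; there)
open import Data.Maybe using (Maybe; just; nothing; _>>=_)
open import Data.Maybe.Properties using (just-injective; ≡-dec)
open import Data.Product using (Σ; _×_; ∃; _,_; proj₁; proj₂)
open import Data.Sum using (_⊎_; inj₁; inj₂)
open import Data.Empty using (⊥-elim)
open import Function using (_∘_; flip)
open import Function.Bundles using (_⇔_; mk⇔; module Equivalence)
open import Relation.Binary.PropositionalEquality using (_≡_; _≢_; refl; sym; trans; cong; subst)
open import Relation.Nullary using (¬_; Dec; yes; no; does; ¬?; _×-dec_; contradiction)
open import Relation.Nullary.Decidable using (dec-true)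
open import Relation.Unary using (Decidable)

private variable
  k l m n : ℕ
  x : Fin n
  p S L D : Subset n

∣p∪q∣≡∣p─q∣+∣q∣ : (p q : Subset n) → ∣ p ∪ q ∣ ≡ ∣ p ─ q ∣ + ∣ q ∣
∣p∪q∣≡∣p─q∣+∣q∣ [] [] = refl
∣p∪q∣≡∣p─q∣+∣q∣ (true ∷ p) (true ∷ q) = trans (cong suc (∣p∪q∣≡∣p─q∣+∣q∣ p q)) (sym (+-suc _ _))
∣p∪q∣≡∣p─q∣+∣q∣ (false ∷ p) (true ∷ q) = trans (cong suc (∣p∪q∣≡∣p─q∣+∣q∣ p q)) (sym (+-suc _ _))
∣p∪q∣≡∣p─q∣+∣q∣ (true ∷ p) (false ∷ q) = cong suc (∣p∪q∣≡∣p─q∣+∣q∣ p q)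
∣p∪q∣≡∣p─q∣+∣q∣ (false ∷ p) (false ∷ q) = ∣p∪q∣≡∣p─q∣+∣q∣ p q

∣p∣≤∣p─q∣+∣q∣ : (p q : Subset n) → ∣ p ∣ ≤ ∣ p ─ q ∣ + ∣ q ∣
∣p∣≤∣p─q∣+∣q∣ p q = ≤-trans (∣p∣≤∣p∪q∣ p q) (≤-reflexive (∣p∪q∣≡∣p─q∣+∣q∣ p q))

∣p∣+∣q∣≤∣p∪q∣ : (p q : Subset n) → (∀ {x} → x ∈ p → x ∉ q) → ∣ p ∣ + ∣ q ∣ ≤ ∣ p ∪ q ∣
∣p∣+∣q∣≤∣p∪q∣ p q disjoint = begin
  ∣ p ∣ + ∣ q ∣      ≤⟨ +-monoˡ-≤ ∣ q ∣ (p⊆q⇒∣p∣≤∣q∣ λ x∈p → x∈p∧x∉q⇒x∈p─q x∈p (disjoint x∈p)) ⟩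
  ∣ p ─ q ∣ + ∣ q ∣  ≡⟨ sym (∣p∪q∣≡∣p─q∣+∣q∣ p q) ⟩
  ∣ p ∪ q ∣          ∎
  where open ≤-Reasoning

x∈p─q⇒x∉q : (p q : Subset n) → x ∈ p ─ q → x ∉ q
x∈p─q⇒x∉q (_ ∷ p) (true ∷ q) (there x∈p─q) (there x∈q) = x∈p─q⇒x∉q p q x∈p─q x∈q
x∈p─q⇒x∉q (_ ∷ p) (false ∷ q) (there x∈p─q) (there x∈q) = x∈p─q⇒x∉q p q x∈p─q x∈q

∣Empty∣≡0 : Empty p → ∣ p ∣ ≡ 0
∣Empty∣≡0 {n} empty = trans (cong ∣_∣ (Empty-unique empty)) (∣⊥∣≡0 n)

positive⇒Nonempty : (p : Subset n) → 1 ≤ ∣ p ∣ → Nonempty p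
positive⇒Nonempty p 1≤∣p∣ with nonempty? p
... | yes nonempty = nonempty
... | no empty with () ← subst (1 ≤_) (∣Empty∣≡0 empty) 1≤∣p∣

∣∣-injection : {p : Subset k} {q : Subset l} (R : Fin k → Fin l → Set) →
  (∀ {i i′ j} → R i j → R i′ j → i ≡ i′) →
  (∀ {i} → i ∈ p → ∃ λ j → j ∈ q × R i j) →
  ∣ p ∣ ≤ ∣ q ∣
∣∣-injection {p = []} R injective partner = z≤n
∣∣-injection {p = false ∷ p} R injective partner =
  ∣∣-injection (R ∘ suc) (λ r r′ → suc-injective (injective r r′)) (partner ∘ there)
∣∣-injection {p = true ∷ p} {q} R injective partner with partner here
... | j₀ , j₀∈q , r₀ = ≤-<-trans ∣p∣≤∣q-j₀∣ (x∈p⇒∣p-x∣<∣p∣ j₀∈q)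
  where
  -- The other elements of p have partners in q - j₀, since j₀ is taken by zero.
  partner′ : ∀ {i} → i ∈ p → ∃ λ j → j ∈ q - j₀ × R (suc i) j
  partner′ i∈p with partner (there i∈p)
  ... | j , j∈q , r = j , x∈p∧x≢y⇒x∈p-y j∈q (λ { refl → 0≢1+n (injective r₀ r) }) , r
  ∣p∣≤∣q-j₀∣ : ∣ p ∣ ≤ ∣ q - j₀ ∣
  ∣p∣≤∣q-j₀∣ = ∣∣-injection (R ∘ suc) (λ r r′ → suc-injective (injective r r′)) partner′

-- A bipartite graph is given by the neighbourhood E a of each left vertex a, and the
-- neighbourhood of a set S of left vertices is bigUnion S E = ⋃_{a ∈ S} E a.
∈⋃⁻ : (ps : List (Subset n)) → x ∈ ⋃ ps → ∃ λ p → p ∈ₗ ps × x ∈ p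
∈⋃⁻ [] x∈⊥ = contradiction x∈⊥ ∉⊥
∈⋃⁻ (p ∷ ps) x∈ with x∈p∪q⁻ p (⋃ ps) x∈
... | inj₁ x∈p = p , here refl , x∈p
... | inj₂ x∈⋃ps with ∈⋃⁻ ps x∈⋃ps
...   | q , q∈ps , x∈q = q , there q∈ps , x∈q

∈⋃⁺ : {ps : List (Subset n)} → p ∈ₗ ps → x ∈ p → x ∈ ⋃ ps
∈⋃⁺ (here refl) x∈p = x∈p∪q⁺ (inj₁ x∈p)
∈⋃⁺ (there p∈ps) x∈p = x∈p∪q⁺ (inj₂ (∈⋃⁺ p∈ps x∈p))

∈bigUnion⁻ : (S : Subset m) (E : Fin m → Subset n) → x ∈ bigUnion S E → ∃ λ a → a ∈ S × x ∈ E a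
∈bigUnion⁻ {m} S E x∈ with ∈⋃⁻ (map E (filter (_∈? S) (allFin m))) x∈
... | _ , p∈ , x∈p with ∈-map∘filter⁻ E (_∈? S) {xs = allFin m} p∈
...   | a , _ , refl , a∈S = a , a∈S , x∈p

∈bigUnion⁺ : {a : Fin m} {E : Fin m → Subset n} → a ∈ S → x ∈ E a → x ∈ bigUnion S E
∈bigUnion⁺ {a = a} {E} a∈S x∈Ea = ∈⋃⁺ (∈-map∘filter⁺ E (_∈? _) (a , ∈-allFin a , refl , a∈S)) x∈Ea

bigUnion-∪ : (S T : Subset m) (E : Fin m → Subset n) → bigUnion (S ∪ T) E ⊆ bigUnion S E ∪ bigUnion T E
bigUnion-∪ S T E x∈ with ∈bigUnion⁻ (S ∪ T) E x∈
... | a , a∈S∪T , x∈Ea with x∈p∪q⁻ S T a∈S∪T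
...   | inj₁ a∈S = x∈p∪q⁺ (inj₁ (∈bigUnion⁺ a∈S x∈Ea))
...   | inj₂ a∈T = x∈p∪q⁺ (inj₂ (∈bigUnion⁺ a∈T x∈Ea))

bigUnion-─ : (S : Subset m) (E : Fin m → Subset n) (T : Subset n) →
  bigUnion S E ─ T ⊆ bigUnion S (λ a → E a ─ T)
bigUnion-─ S E T {x} x∈ with ∈bigUnion⁻ S E (p─q⊆p _ T x∈)
... | a , a∈S , x∈Ea = ∈bigUnion⁺ a∈S (x∈p∧x∉q⇒x∈p─q x∈Ea (x∈p─q⇒x∉q _ T x∈))

record Matching (Adj : Fin m → Fin n → Set) (X : Subset m) : Set where
  field
    assign : Fin m → Maybe (Fin n)
    injective : InjectivePartial assign
    sound : ∀ {a b} → assign a ≡ just b → Adj a b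
    saturates : ∀ {a} → a ∈ X → ∃ λ b → assign a ≡ just b

open Matching

Graph : (Fin m → Subset n) → Fin m → Fin n → Set
Graph E a b = b ∈ E a

weaken : {Adj Adj′ : Fin m → Fin n → Set} → (∀ {a b} → Adj a b → Adj′ a b) →
  Matching Adj L → Matching Adj′ L
weaken Adj⇒Adj′ M = record
  { assign = assign M ; injective = injective M ; sound = Adj⇒Adj′ ∘ sound M ; saturates = saturates M }

HallCondition : (Fin m → Subset n) → Subset m → Set
HallCondition E L = ∀ S → S ⊆ L → ∣ bigUnion S E ∣ ≥ ∣ S ∣

hall-necessary : (E : Fin m → Subset n) (R : Fin m → Fin n → Set) →
  (∀ {a a′ b} → R a b → R a′ b → a ≡ a′) →
  (∀ {a} → a ∈ L → ∃ λ b → b ∈ E a × R a b) →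
  HallCondition E L
hall-necessary E R injective partner S S⊆L = ∣∣-injection R injective partnerInN
  where
  partnerInN : ∀ {a} → a ∈ S → ∃ λ b → b ∈ bigUnion S E × R a b
  partnerInN a∈S with partner (S⊆L a∈S)
  ... | b , b∈Ea , r = b , ∈bigUnion⁺ a∈S b∈Ea , r

emptyMatching : {E : Fin m → Subset n} → Empty L → Matching (Graph E) L
emptyMatching empty = record
  { assign = λ _ → nothing ; injective = λ _ _ _ () ; sound = λ () ; saturates = λ a∈L → contradiction (_ , a∈L) empty }

edgeMatching : {E : Fin m → Subset n} (a : Fin m) (b : Fin n) → b ∈ E a → Matching (Graph E) ⁅ a ⁆
edgeMatching {m} {n} {E} a b b∈Ea = record
  { assign = edge ; injective = edge-injective ; sound = edge-sound ; saturates = edge-saturates }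
  where
  edge : Fin m → Maybe (Fin n)
  edge x with x ≟ a
  ... | yes _ = just b
  ... | no _ = nothing
  edge-injective : InjectivePartial edge
  edge-injective x x′ _ _ _ with x ≟ a | x′ ≟ a
  edge-injective x x′ _ _ _ | yes refl | yes refl = refl
  edge-sound : ∀ {x c} → edge x ≡ just c → c ∈ E x
  edge-sound {x} e with x ≟ a
  ... | yes refl = subst (_∈ E a) (just-injective e) b∈Ea
  edge-saturates : ∀ {x} → x ∈ ⁅ a ⁆ → ∃ λ c → edge x ≡ just c
  edge-saturates {x} x∈⁅a⁆ with x ≟ a
  ... | yes _ = b , refl
  ... | no x≢a = contradiction (x∈⁅y⁆⇒x≡y a x∈⁅a⁆) x≢a

glue : {E : Fin m → Subset n} (D : Subset m) (T : Subset n) (M₁ : Matching (Graph E) D) →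
  (∀ {a b} → a ∈ D → assign M₁ a ≡ just b → b ∈ T) →
  Matching (Graph (λ a → E a ─ T)) (L ─ D) → Matching (Graph E) L
glue {m} {n} {L = L} {E} D T M₁ M₁⊆T M₂ = record
  { assign = glued ; injective = glued-injective ; sound = glued-sound ; saturates = glued-saturates }
  where
  glued : Fin m → Maybe (Fin n)
  glued a with a ∈? D
  ... | yes _ = assign M₁ a
  ... | no _ = assign M₂ a
  -- The two parts have disjoint images: the first lies in T, the second outside it.
  disjoint : ∀ {a a′ b} → a ∈ D → assign M₁ a ≡ just b → ¬ assign M₂ a′ ≡ just b
  disjoint a∈D e₁ e₂ = x∈p─q⇒x∉q _ T (sound M₂ e₂) (M₁⊆T a∈D e₁)
  glued-injective : InjectivePartial glued
  glued-injective a a′ b e e′ with a ∈? D | a′ ∈? D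
  ... | yes _ | yes _ = injective M₁ a a′ b e e′
  ... | no _ | no _ = injective M₂ a a′ b e e′
  ... | yes a∈D | no _ = ⊥-elim (disjoint a∈D e e′)
  ... | no _ | yes a′∈D = ⊥-elim (disjoint a′∈D e′ e)
  glued-sound : ∀ {a b} → glued a ≡ just b → b ∈ E a
  glued-sound {a} e with a ∈? D
  ... | yes _ = sound M₁ e
  ... | no _ = p─q⊆p _ T (sound M₂ e)
  glued-saturates : ∀ {a} → a ∈ L → ∃ λ b → glued a ≡ just b
  glued-saturates {a} a∈L with a ∈? D
  ... | yes a∈D = saturates M₁ a∈D
  ... | no a∉D = saturates M₂ (x∈p∧x∉q⇒x∈p─q a∈L a∉D)

hall-restrict : {E : Fin m → Subset n} → HallCondition E L → D ⊆ L → HallCondition E D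
hall-restrict hallL D⊆L S S⊆D = hallL S (D⊆L ∘ S⊆D)

hall-neighbour : {E : Fin m → Subset n} {a : Fin m} → HallCondition E L → a ∈ L → ∃ λ b → b ∈ E a
hall-neighbour {L = L} {E} {a} hallL a∈L with positive⇒Nonempty _ one≤∣N⁅a⁆∣
  where
  one≤∣N⁅a⁆∣ : 1 ≤ ∣ bigUnion ⁅ a ⁆ E ∣
  one≤∣N⁅a⁆∣ = subst (_≤ ∣ bigUnion ⁅ a ⁆ E ∣) (∣⁅x⁆∣≡1 a) (hallL ⁅ a ⁆ λ x∈⁅a⁆ → subst (_∈ L) (sym (x∈⁅y⁆⇒x≡y a x∈⁅a⁆)) a∈L)
... | b , b∈N with ∈bigUnion⁻ ⁅ a ⁆ E b∈N
...   | a′ , a′∈⁅a⁆ , b∈Ea′ = b , subst (λ c → b ∈ E c) (x∈⁅y⁆⇒x≡y a a′∈⁅a⁆) b∈Ea′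

Tight : (Fin m → Subset n) → Subset m → Subset m → Set
Tight E L D = D ⊆ L × Nonempty D × ∣ D ∣ < ∣ L ∣ × ∣ bigUnion D E ∣ ≤ ∣ D ∣

tight? : (E : Fin m → Subset n) (L : Subset m) → Decidable (Tight E L)
tight? E L D = (D ⊆? L) ×-dec nonempty? D ×-dec (∣ D ∣ <? ∣ L ∣) ×-dec (∣ bigUnion D E ∣ ≤? ∣ D ∣)

hall-after-tight : {E : Fin m → Subset n} → HallCondition E L → D ⊆ L → ∣ bigUnion D E ∣ ≤ ∣ D ∣ →
  HallCondition (λ a → E a ─ bigUnion D E) (L ─ D)
hall-after-tight {L = L} {D} {E} hallL D⊆L tight S S⊆L─D = +-cancelʳ-≤ ∣ D ∣ _ _ (begin
  ∣ S ∣ + ∣ D ∣                   ≤⟨ ∣p∣+∣q∣≤∣p∪q∣ S D (λ x∈S → x∈p─q⇒x∉q L D (S⊆L─D x∈S)) ⟩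
  ∣ S ∪ D ∣                       ≤⟨ hallL (S ∪ D) S∪D⊆L ⟩
  ∣ bigUnion (S ∪ D) E ∣          ≤⟨ p⊆q⇒∣p∣≤∣q∣ (bigUnion-∪ S D E) ⟩
  ∣ NS ∪ ND ∣                     ≡⟨ ∣p∪q∣≡∣p─q∣+∣q∣ NS ND ⟩
  ∣ NS ─ ND ∣ + ∣ ND ∣            ≤⟨ +-monoˡ-≤ ∣ ND ∣ (p⊆q⇒∣p∣≤∣q∣ (bigUnion-─ S E ND)) ⟩
  ∣ N′S ∣ + ∣ ND ∣                ≤⟨ +-monoʳ-≤ ∣ N′S ∣ tight ⟩
  ∣ N′S ∣ + ∣ D ∣                 ∎)
  where
  open ≤-Reasoning
  NS ND N′S : Subset _
  NS = bigUnion S E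
  ND = bigUnion D E
  N′S = bigUnion S (λ a → E a ─ ND)
  S∪D⊆L : S ∪ D ⊆ L
  S∪D⊆L x∈S∪D with x∈p∪q⁻ S D x∈S∪D
  ... | inj₁ x∈S = p─q⊆p L D (S⊆L─D x∈S)
  ... | inj₂ x∈D = D⊆L x∈D

-- Loose case: if L has no tight set, removing any a ∈ L and any right vertex b preserves
-- Hall's condition, since a nonempty S ⊆ L - a then has ∣ S ∣ + 1 ≤ ∣ N(S) ∣.
hall-after-loose : {E : Fin m → Subset n} {a : Fin m} → HallCondition E L → ¬ ∃ (Tight E L) →
  a ∈ L → (b : Fin n) → HallCondition (λ x → E x ─ ⁅ b ⁆) (L - a)
hall-after-loose {L = L} {E} {a} hallL noTight a∈L b S S⊆L-a with nonempty? S
... | no empty = subst (_≤ ∣ bigUnion S (λ x → E x ─ ⁅ b ⁆) ∣) (sym (∣Empty∣≡0 empty)) z≤n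
... | yes nonempty = +-cancelʳ-≤ 1 _ _ (begin
  ∣ S ∣ + 1                       ≡⟨ +-comm ∣ S ∣ 1 ⟩
  suc ∣ S ∣                       ≤⟨ ≰⇒> (λ notLarger → noTight (S , S⊆L , nonempty , ∣S∣<∣L∣ , notLarger)) ⟩
  ∣ NS ∣                          ≤⟨ ∣p∣≤∣p─q∣+∣q∣ NS ⁅ b ⁆ ⟩
  ∣ NS - b ∣ + ∣ ⁅ b ⁆ ∣          ≤⟨ +-monoˡ-≤ ∣ ⁅ b ⁆ ∣ (p⊆q⇒∣p∣≤∣q∣ (bigUnion-─ S E ⁅ b ⁆)) ⟩
  ∣ N′S ∣ + ∣ ⁅ b ⁆ ∣             ≡⟨ cong (∣ N′S ∣ +_) (∣⁅x⁆∣≡1 b) ⟩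
  ∣ N′S ∣ + 1                     ∎)
  where
  open ≤-Reasoning
  NS N′S : Subset _
  NS = bigUnion S E
  N′S = bigUnion S (λ x → E x ─ ⁅ b ⁆)
  S⊆L : S ⊆ L
  S⊆L = p─q⊆p L ⁅ a ⁆ ∘ S⊆L-a
  ∣S∣<∣L∣ : ∣ S ∣ < ∣ L ∣
  ∣S∣<∣L∣ = ≤-<-trans (p⊆q⇒∣p∣≤∣q∣ S⊆L-a) (x∈p⇒∣p-x∣<∣p∣ a∈L)

-- If L has a
-- tight set D, match D and L ─ D separately; otherwise match one a ∈ L to any
-- neighbour b and recurse on L - a in the graph without b.
hall-bounded : (k : ℕ) (E : Fin m → Subset n) (L : Subset m) → ∣ L ∣ < k →
  HallCondition E L → Matching (Graph E) L
hall-bounded (suc k) E L (s≤s ∣L∣≤k) hallL with anySubset? (tight? E L)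
... | yes (D , D⊆L , (x , x∈D) , ∣D∣<∣L∣ , tight) = glue D (bigUnion D E) M₁ M₁⊆ND M₂
  where
  M₁ : Matching (Graph E) D
  M₁ = hall-bounded k E D (<-≤-trans ∣D∣<∣L∣ ∣L∣≤k) (hall-restrict hallL D⊆L)
  M₁⊆ND : ∀ {a b} → a ∈ D → assign M₁ a ≡ just b → b ∈ bigUnion D E
  M₁⊆ND a∈D e = ∈bigUnion⁺ a∈D (sound M₁ e)
  ∣L─D∣<∣L∣ : ∣ L ─ D ∣ < ∣ L ∣
  ∣L─D∣<∣L∣ = p∩q≢∅⇒∣p─q∣<∣p∣ L D (x , x∈p∩q⁺ (D⊆L x∈D , x∈D))
  M₂ : Matching (Graph (λ a → E a ─ bigUnion D E)) (L ─ D)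
  M₂ = hall-bounded k _ (L ─ D) (<-≤-trans ∣L─D∣<∣L∣ ∣L∣≤k) (hall-after-tight hallL D⊆L tight)
... | no noTight with nonempty? L
...   | no empty = emptyMatching empty
...   | yes (a , a∈L) with hall-neighbour hallL a∈L
...     | b , b∈Ea = glue ⁅ a ⁆ ⁅ b ⁆ (edgeMatching a b b∈Ea) edge⊆⁅b⁆ M′
  where
  edge⊆⁅b⁆ : ∀ {x c} → x ∈ ⁅ a ⁆ → assign (edgeMatching {E = E} a b b∈Ea) x ≡ just c → c ∈ ⁅ b ⁆
  edge⊆⁅b⁆ {x} _ e with x ≟ a
  ... | yes _ = subst (_∈ ⁅ b ⁆) (just-injective e) (x∈⁅x⁆ b)
  M′ : Matching (Graph (λ x → E x ─ ⁅ b ⁆)) (L - a)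
  M′ = hall-bounded k _ (L - a) (<-≤-trans (x∈p⇒∣p-x∣<∣p∣ a∈L) ∣L∣≤k) (hall-after-loose hallL noTight a∈L b)

hall : (E : Fin m → Subset n) (L : Subset m) → HallCondition E L → Matching (Graph E) L
hall E L = hall-bounded (suc ∣ L ∣) E L ≤-refl

ascend : {State : Set} {Final : State → Set} (μ : State → ℕ) (B : ℕ) → (∀ s → μ s ≤ B) →
  (∀ s → Final s ⊎ Σ State (λ s′ → μ s < μ s′)) → State → Σ State Final
ascend {State} {Final} μ B bounded improve s₀ = go (suc B) s₀ (m≤n+m (suc B) (μ s₀))
  where
  go : (k : ℕ) (s : State) → B < μ s + k → Σ State Final
  go zero s B<μs+0 = contradiction (subst (B <_) (+-identityʳ (μ s)) B<μs+0) (≤⇒≯ (bounded s))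
  go (suc k) s B<μs+k+1 with improve s
  ... | inj₁ final = s , final
  ... | inj₂ (s′ , μs<μs′) = go k s′ (≤-trans B<μs+k+1 (≤-trans (≤-reflexive (+-suc (μ s) k)) (+-monoˡ-≤ k μs<μs′)))

select : {P : Fin n → Set} → Decidable P → Subset n
select P? = tabulate (λ x → does (P? x))

∈select⁺ : {P : Fin n → Set} (P? : Decidable P) → P x → x ∈ select P?
∈select⁺ {x = x} P? px = lookup⇒[]= x (select P?) (trans (lookup∘tabulate _ x) (dec-true (P? x) px))

∈select⁻ : {P : Fin n → Set} (P? : Decidable P) → x ∈ select P? → P x
∈select⁻ {x = x} P? x∈ with P? x | trans (sym (lookup∘tabulate _ x)) ([]=⇒lookup x∈)
... | yes px | _ = px

module Merge {Adj : Fin m → Fin n → Set} {X : Subset m} {Y : Subset n} (h : Matching (flip Adj) Y) where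

  -- M agrees with h at a when M and h pair a with the same partner.
  Agrees : Matching Adj X → Fin m → Set
  Agrees M a = (assign M a >>= assign h) ≡ just a

  agrees? : (M : Matching Adj X) → Decidable (Agrees M)
  agrees? M a = ≡-dec _≟_ (assign M a >>= assign h) (just a)

  -- The agreement set; its size is the measure that each redirection increases.
  agreement : Matching Adj X → Subset m
  agreement M = select (agrees? M)

  redirect : (M : Matching Adj X) (y : Fin n) (a₁ : Fin m) → assign h y ≡ just a₁ →
    (∀ a → assign M a ≢ just y) → Matching Adj X
  redirect M y a₁ hy unused = record
    { assign = F ; injective = F-injective ; sound = F-sound ; saturates = F-saturates }
    where
    F : Fin m → Maybe (Fin n)
    F x with x ≟ a₁
    ... | yes _ = just y
    ... | no _ = assign M x
    F-injective : InjectivePartial F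
    F-injective x x′ c e e′ with x ≟ a₁ | x′ ≟ a₁
    ... | yes refl | yes refl = refl
    ... | no _ | no _ = injective M x x′ c e e′
    ... | yes _ | no _ with refl ← e = contradiction e′ (unused x′)
    ... | no _ | yes _ with refl ← e′ = contradiction e (unused x)
    F-sound : ∀ {x c} → F x ≡ just c → Adj x c
    F-sound {x} e with x ≟ a₁
    ... | yes refl = subst (Adj a₁) (just-injective e) (sound h hy)
    ... | no _ = sound M e
    F-saturates : ∀ {x} → x ∈ X → ∃ λ c → F x ≡ just c
    F-saturates {x} x∈X with x ≟ a₁
    ... | yes _ = y , refl
    ... | no _ = saturates M x∈X

  redirect-agrees-more : (M : Matching Adj X) (y : Fin n) (a₁ : Fin m) (hy : assign h y ≡ just a₁)
    (unused : ∀ a → assign M a ≢ just y) → agreement M ⊂ agreement (redirect M y a₁ hy unused)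
  redirect-agrees-more M y a₁ hy unused =
    ∈select⁺ (agrees? M′) ∘ kept ∘ ∈select⁻ (agrees? M) ,
    a₁ , ∈select⁺ (agrees? M′) gained , lost ∘ ∈select⁻ (agrees? M)
    where
    M′ : Matching Adj X
    M′ = redirect M y a₁ hy unused
    kept : ∀ {x} → Agrees M x → Agrees M′ x
    kept {x} agrees with x ≟ a₁
    ... | yes refl = hy
    ... | no _ = agrees
    gained : Agrees M′ a₁
    gained with a₁ ≟ a₁
    ... | yes _ = hy
    ... | no a₁≢a₁ = contradiction refl a₁≢a₁
    lost : ¬ Agrees M a₁
    lost agrees with assign M a₁ in e
    ... | just b with injective h b y a₁ agrees hy
    ...   | refl = unused a₁ e

  UsesY : Matching Adj X → Set
  UsesY M = ∀ {b} → b ∈ Y → ∃ λ a → assign M a ≡ just b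

  used? : (M : Matching Adj X) (b : Fin n) → Dec (∃ λ a → assign M a ≡ just b)
  used? M b = any? (λ a → ≡-dec _≟_ (assign M a) (just b))

  improve : (M : Matching Adj X) → UsesY M ⊎ Σ (Matching Adj X) (λ M′ → ∣ agreement M ∣ < ∣ agreement M′ ∣)
  improve M with any? (λ y → (y ∈? Y) ×-dec ¬? (used? M y))
  ... | yes (y , y∈Y , y-unused) with saturates h y∈Y
  ...   | a₁ , hy = inj₂ (redirect M y a₁ hy unused , p⊂q⇒∣p∣<∣q∣ (redirect-agrees-more M y a₁ hy unused))
    where
    unused : ∀ a → assign M a ≢ just y
    unused a e = y-unused (a , e)
  improve M | no noneUnused = inj₁ usesY
    where
    usesY : UsesY M
    usesY {b} b∈Y with used? M b
    ... | yes used = used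
    ... | no unused = contradiction (b , b∈Y , unused) noneUnused

  merge : Matching Adj X → Σ (Matching Adj X) UsesY
  merge = ascend (∣_∣ ∘ agreement) m (λ M → ∣p∣≤n (agreement M)) improve

mendelsohn-dulmage : {Adj : Fin m → Fin n → Set} {X : Subset m} {Y : Subset n} →
  Matching Adj X → Matching (flip Adj) Y →
  Σ (Matching Adj X) λ M → ∀ {b} → b ∈ Y → ∃ λ a → assign M a ≡ just b
mendelsohn-dulmage f h = Merge.merge h f

∧-guard⇔ : (a c d : Bool) → a ∧ (not c ∨ d) ≡ true ⇔ (a ≡ true × (c ≡ true → d ≡ true))
∧-guard⇔ false c d = mk⇔ (λ ()) (λ { (() , _) })
∧-guard⇔ true false d = mk⇔ (λ _ → refl , λ ()) (λ _ → refl)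
∧-guard⇔ true true d = mk⇔ (λ e → refl , λ _ → e) (λ (_ , imp) → imp refl)

∈-guarded : (A C : Subset k) (D : Fin k → Subset l) (y : Fin l) {x : Fin k} →
  x ∈ tabulate (λ x → lookup A x ∧ (not (lookup C x) ∨ lookup (D x) y)) ⇔ (x ∈ A × (x ∈ C → y ∈ D x))
∈-guarded {k = k} A C D y {x} = mk⇔ to from
  where
  guarded : Fin k → Bool
  guarded x = lookup A x ∧ (not (lookup C x) ∨ lookup (D x) y)
  module Guard = Equivalence (∧-guard⇔ (lookup A x) (lookup C x) (lookup (D x) y))
  to : x ∈ tabulate guarded → x ∈ A × (x ∈ C → y ∈ D x)
  to x∈ with Guard.to (trans (sym (lookup∘tabulate guarded x)) ([]=⇒lookup x∈))
  ... | x∈A , imp = lookup⇒[]= x A x∈A , λ x∈C → lookup⇒[]= y (D x) (imp ([]=⇒lookup x∈C))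
  from : x ∈ A × (x ∈ C → y ∈ D x) → x ∈ tabulate guarded
  from (x∈A , imp) = lookup⇒[]= x (tabulate guarded) (trans (lookup∘tabulate guarded x)
    (Guard.from ([]=⇒lookup x∈A , λ x∈C → []=⇒lookup (imp (lookup⇒[]= x C x∈C)))))

module _ (Bl : Fin m → Subset n) (Gl : Fin n → Subset m) where

  ∈BStar : {g : Fin m} {b : Fin n} → b ∈ BStar Bl Gl g ⇔ (b ∈ Bl g × (b ∈ BoysL Gl → g ∈ Gl b))
  ∈BStar {g} = ∈-guarded (Bl g) (BoysL Gl) Gl g

  ∈GStar : {g : Fin m} {b : Fin n} → g ∈ GStar Bl Gl b ⇔ (g ∈ Gl b × (g ∈ GirlsL Bl → b ∈ Bl g))
  ∈GStar {b = b} = ∈-guarded (Gl b) (GirlsL Bl) Bl b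

  Compatible : Fin m → Fin n → Set
  Compatible g b = b ∈ BStar Bl Gl g ⊎ g ∈ GStar Bl Gl b

  compatible⇒Bl : {g : Fin m} {b : Fin n} → Compatible g b → g ∈ GirlsL Bl → b ∈ Bl g
  compatible⇒Bl (inj₁ b∈B*g) _ = proj₁ (Equivalence.to ∈BStar b∈B*g)
  compatible⇒Bl (inj₂ g∈G*b) g∈GL = proj₂ (Equivalence.to ∈GStar g∈G*b) g∈GL

  compatible⇒Gl : {g : Fin m} {b : Fin n} → Compatible g b → b ∈ BoysL Gl → g ∈ Gl b
  compatible⇒Gl (inj₁ b∈B*g) b∈BL = proj₂ (Equivalence.to ∈BStar b∈B*g) b∈BL
  compatible⇒Gl (inj₂ g∈G*b) _ = proj₁ (Equivalence.to ∈GStar g∈G*b)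

  MarriageScheme : Set
  MarriageScheme = Σ (Fin m → Maybe (Fin n)) λ P →
      InjectivePartial P
    × (∀ g → g ∈ GirlsL Bl → ∃ λ b → P g ≡ just b)
    × (∀ b → b ∈ BoysL Gl → ∃ λ g → P g ≡ just b)
    × (∀ g b → g ∈ GirlsL Bl → P g ≡ just b → b ∈ Bl g)
    × (∀ g b → b ∈ BoysL Gl → P g ≡ just b → g ∈ Gl b)

  HallConditions : Set
  HallConditions = HallCondition (GStar Bl Gl) (BoysL Gl) × HallCondition (BStar Bl Gl) (GirlsL Bl)

  scheme⇒hall : MarriageScheme → HallConditions
  scheme⇒hall (P , P-injective , marriedG , marriedB , inBl , inGl) = boysHall , girlsHall
    where
    boysHall : HallCondition (GStar Bl Gl) (BoysL Gl)
    boysHall = hall-necessary (GStar Bl Gl) (λ b g → P g ≡ just b) (λ e e′ → just-injective (trans (sym e) e′)) wife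
      where
      wife : ∀ {b} → b ∈ BoysL Gl → ∃ λ g → g ∈ GStar Bl Gl b × P g ≡ just b
      wife {b} b∈BL with marriedB b b∈BL
      ... | g , e = g , Equivalence.from ∈GStar (inGl g b b∈BL e , λ g∈GL → inBl g b g∈GL e) , e
    girlsHall : HallCondition (BStar Bl Gl) (GirlsL Bl)
    girlsHall = hall-necessary (BStar Bl Gl) (λ g b → P g ≡ just b) (λ e e′ → P-injective _ _ _ e e′) husband
      where
      husband : ∀ {g} → g ∈ GirlsL Bl → ∃ λ b → b ∈ BStar Bl Gl g × P g ≡ just b
      husband {g} g∈GL with marriedG g g∈GL
      ... | b , e = b , Equivalence.from ∈BStar (inBl g b g∈GL e , λ b∈BL → inGl g b b∈BL e) , e

  hall⇒scheme : HallConditions → MarriageScheme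
  hall⇒scheme (boysHall , girlsHall) with mendelsohn-dulmage girlsMatching boysMatching
    where
    girlsMatching : Matching Compatible (GirlsL Bl)
    girlsMatching = weaken inj₁ (hall (BStar Bl Gl) (GirlsL Bl) girlsHall)
    boysMatching : Matching (flip Compatible) (BoysL Gl)
    boysMatching = weaken inj₂ (hall (GStar Bl Gl) (BoysL Gl) boysHall)
  ... | M , usesBL =
    assign M , injective M , (λ _ → saturates M) , (λ _ → usesBL) ,
    (λ _ _ g∈GL e → compatible⇒Bl (sound M e) g∈GL) , (λ _ _ b∈BL e → compatible⇒Gl (sound M e) b∈BL)

corollary1 : ∀ {m n} (Bl : Fin m → Subset n) (Gl : Fin n → Subset m) →
    (Σ (Fin m → Maybe (Fin n)) λ P →
        InjectivePartial P
      × (∀ g → g ∈ GirlsL Bl → ∃ λ b → P g ≡ just b)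
      × (∀ b → b ∈ BoysL Gl → ∃ λ g → P g ≡ just b)
      × (∀ g b → g ∈ GirlsL Bl → P g ≡ just b → b ∈ Bl g)
      × (∀ g b → b ∈ BoysL Gl → P g ≡ just b → g ∈ Gl b))
    ⇔
    ((∀ (β : Subset n) → β ⊆ BoysL Gl → ∣ bigUnion β (GStar Bl Gl) ∣ ≥ ∣ β ∣)
      × (∀ (γ : Subset m) → γ ⊆ GirlsL Bl → ∣ bigUnion γ (BStar Bl Gl) ∣ ≥ ∣ γ ∣))
corollary1 Bl Gl = mk⇔ (scheme⇒hall Bl Gl) (hall⇒scheme Bl Gl)
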